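{- Let $G$ be a cycle of length exceeding four. Then $G$ is an induced-subgraph-minimal non-sesquicograph.
   Context: For vertex-disjoint graphs $G$ and $H$: the $0$-sum is their disjoint union; a $1$-sum is obtained from the disjoint union by identifying one vertex of $G$ with one vertex of $H$; the join is obtained from the disjoint union by adding all edges between $V(G)$ and $V(H)$. A sesquicograph is a finite simple graph that can be generated from the one-vertex graph $K_1$ using joins, $0$-sums and $1$-sums. An induced-subgraph-minimal non-sesquicograph is a graph that is not a sesquicograph but every proper induced subgraph of which is a sesquicograph. -}

module Defs where

import Data.Nat
open import Data.Nat using (ℕ; zero; suc; _+_; _≤_; _<_; _%_; _≡ᵇ_; z≤n; s≤s)
open import Data.Nat.Properties using (≡ᵇ⇒≡; <-cmp; 1+n≢n)
open import Data.Nat.DivMod using (m<n⇒m%n≡m; n%n≡0)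
open import Data.Fin using (Fin; toℕ)
open import Data.Fin.Properties using (toℕ<n)
open import Data.Bool using (Bool; true; false; _∨_; T)
open import Data.Bool.Properties using (∨-comm)
open import Data.Product using (Σ; ∃; _×_; _,_)
open import Data.Sum using (_⊎_)
open import Data.Empty using (⊥; ⊥-elim)
open import Relation.Nullary using (¬_)
open import Relation.Binary using (tri<; tri≈; tri>)
open import Relation.Binary.PropositionalEquality
open import Function.Definitions using (Injective)
open import Function.Bundles using (_⤖_; Bijection)

record Graph : Set where
  field
    order : ℕ
    adj   : Fin order → Fin order → Bool
    adj-sym : ∀ u v → adj u v ≡ adj v u
    adj-irr : ∀ v → adj v v ≡ false
open Graph public

_≅_ : Graph → Graph → Set
G ≅ H = Σ (Fin (order G) ⤖ Fin (order H)) λ φ →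
  ∀ u v → adj H (Bijection.to φ u) (Bijection.to φ v) ≡ adj G u v

-- K is a 0-sum / join / 1-sum of G and H (up to isomorphism):
-- V(K) is covered by injective images of V(G) and V(H), adjacency
-- inside each image is that of G resp. H, and the images and the
-- cross-adjacency are as prescribed by the operation.

record Covering (K G H : Graph) : Set where
  field
    f     : Fin (order G) → Fin (order K)
    k     : Fin (order H) → Fin (order K)
    f-inj : Injective _≡_ _≡_ f
    k-inj : Injective _≡_ _≡_ k
    cover : ∀ v → (∃ λ x → f x ≡ v) ⊎ (∃ λ y → k y ≡ v)
    adjG  : ∀ x x′ → adj K (f x) (f x′) ≡ adj G x x′
    adjH  : ∀ y y′ → adj K (k y) (k y′) ≡ adj H y y′

ZeroSum : Graph → Graph → Graph → Set
ZeroSum K G H = Σ (Covering K G H) λ c → let open Covering c in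
  (∀ x y → ¬ (f x ≡ k y)) × (∀ x y → adj K (f x) (k y) ≡ false)

Join : Graph → Graph → Graph → Set
Join K G H = Σ (Covering K G H) λ c → let open Covering c in
  (∀ x y → ¬ (f x ≡ k y)) × (∀ x y → adj K (f x) (k y) ≡ true)

OneSum : Graph → Graph → Graph → Set
OneSum K G H = Σ (Covering K G H) λ c → let open Covering c in
  Σ (Fin (order G)) λ g₀ → Σ (Fin (order H)) λ h₀ →
    (f g₀ ≡ k h₀)
  × (∀ x y → f x ≡ k y → (x ≡ g₀) × (y ≡ h₀))
  × (∀ x y → ¬ (x ≡ g₀) → ¬ (y ≡ h₀) → adj K (f x) (k y) ≡ false)

data Sesqui : Graph → Set where
  k₁   : ∀ {G} → order G ≡ 1 → Sesqui G
  join : ∀ {K G H} → Sesqui G → Sesqui H → Join K G H → Sesqui K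
  sum₀ : ∀ {K G H} → Sesqui G → Sesqui H → ZeroSum K G H → Sesqui K
  sum₁ : ∀ {K G H} → Sesqui G → Sesqui H → OneSum K G H → Sesqui K

induced : (G : Graph) {m : ℕ} (e : Fin m → Fin (order G)) → Graph
induced G {m} e = record
  { order = m
  ; adj   = λ u v → adj G (e u) (e v)
  ; adj-sym = λ u v → adj-sym G (e u) (e v)
  ; adj-irr = λ v → adj-irr G (e v)
  }

-- Proper induced subgraphs are taken on nonempty vertex sets
-- (graphs in this setting are nonempty).
MinimalNonSesqui : Graph → Set
MinimalNonSesqui G =
  ¬ Sesqui G ×
  (∀ {m} (e : Fin m → Fin (order G)) → Injective _≡_ _≡_ e →
     1 ≤ m → m < order G → Sesqui (induced G e))

private
  succMod : ℕ → ℕ → ℕ → Bool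
  succMod n a b = (suc a % suc (suc (suc n))) ≡ᵇ b

  noLoop : ∀ n (a : ℕ) → a < suc (suc (suc n)) → succMod n a a ≡ false
  noLoop n a a<N with (suc a % suc (suc (suc n))) ≡ᵇ a in eq
  ... | false = refl
  ... | true = ⊥-elim (lemma (≡ᵇ⇒≡ _ _ (subst T (sym eq) _)))
    where
    N = suc (suc (suc n))
    lemma : suc a % N ≡ a → ⊥
    lemma p with <-cmp (suc a) N
    ... | tri< lt _ _ = 1+n≢n (trans (sym (m<n⇒m%n≡m lt)) p)
    ... | tri≈ _ q _ = lemma2 (trans (sym (trans (cong (_% N) q) (n%n≡0 N))) p)
      where
      lemma2 : 0 ≡ a → ⊥
      lemma2 z with trans z (cong Data.Nat.pred q)
      ... | ()
    ... | tri> _ _ gt = lemma3 gt a<N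
      where
      lemma3 : N < suc a → a < N → ⊥
      lemma3 (s≤s x) y = ⊥-elim (irrefl x y)
        where
        irrefl : ∀ {p q : ℕ} → q ≤ p → p < q → ⊥
        irrefl z≤n ()
        irrefl (s≤s a) (s≤s b) = irrefl a b

-- cycle k has length k + 3
cycle : ℕ → Graph
cycle n = record
  { order = suc (suc (suc n))
  ; adj   = λ u v → succMod n (toℕ u) (toℕ v) ∨ succMod n (toℕ v) (toℕ u)
  ; adj-sym = λ u v → ∨-comm (succMod n (toℕ u) (toℕ v)) _
  ; adj-irr = λ v → cong₂ _∨_ (noLoop n (toℕ v) (toℕ<n v)) (noLoop n (toℕ v) (toℕ<n v))
  }

module Submission where

-- A sesquicograph with more than one vertex is a join, a 0-sum or a 1-sum of two sesquicographs.
-- A cycle C of length at least five has connected complement, is connected, and stays connected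
-- when any vertex is deleted.  Hence C is neither a join nor a 0-sum of two nonempty graphs, and a
-- 1-sum decomposition of C must glue K₁ to a copy of C itself, which is excluded by induction on
-- the derivation.  Conversely, deleting a vertex of C leaves a path, and every induced subgraph of
-- a path is a sesquicograph: a vertex with the largest label has at most one neighbour, so it is
-- attached by a 0-sum with K₁ or a 1-sum with K₂.

open import Defs
open import Data.Bool using (Bool; true; false; T)
open import Data.Bool.Properties using (T-≡; T-∨; ¬-not) renaming (_≟_ to _≟ᵇ_)
open import Data.Empty using (⊥; ⊥-elim)
open import Data.Fin using (Fin; zero; suc; toℕ; punchIn; punchOut)
open import Data.Fin.Properties
  using (toℕ-injective; toℕ<n; toℕ-fromℕ<; punchIn-injective; punchInᵢ≢i; punchIn-punchOut;
         any?; all?; pigeonhole; ¬∀⟶∃¬; cantor-schröder-bernstein)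
  renaming (_≟_ to _≟ᶠ_)
open import Data.Nat using (ℕ; zero; suc; _+_; _∸_; _≤_; _<_; _%_; _≡ᵇ_; z≤n; s≤s)
open import Data.Nat.DivMod using (_mod_; m%n<n; m<n⇒m%n≡m; m%n%n≡m%n; %-distribˡ-+; [m+n]%n≡m%n)
open import Data.Nat.Properties
  using (≤-refl; ≤-trans; ≤-total; <⇒≤; <⇒≢; ≤⇒≯; <-trans; n<1+n; suc-injective; m≤n⇒m<n∨m≡n;
         n≢0⇒n>0; +-suc; +-assoc; +-comm; +-identityʳ; +-monoʳ-≤; m+[n∸m]≡n; ≡ᵇ⇒≡; ≡⇒≡ᵇ)
open import Data.Product using (∃; _×_; _,_; proj₁; proj₂)
open import Data.Sum using (_⊎_; inj₁; inj₂; [_,_]; [_,_]′)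
import Data.Sum as Sum
open import Function using (_∘_; id; Equivalence)
open import Function.Bundles using (Bijection; Surjection; mk⤖)
open import Function.Definitions using (Injective)
open import Relation.Nullary using (¬_; Dec; yes; no; does; contradiction)
open import Relation.Binary.PropositionalEquality hiding ([_])

module Iso {G H : Graph} (φ : G ≅ H) where

  to : Fin (order G) → Fin (order H)
  to = Bijection.to (proj₁ φ)

  from : Fin (order H) → Fin (order G)
  from = Bijection.to⁻ (proj₁ φ)

  to-injective : Injective _≡_ _≡_ to
  to-injective = Bijection.injective (proj₁ φ)

  to-from : ∀ v → to (from v) ≡ v
  to-from = Surjection.to∘to⁻ (Bijection.surjection (proj₁ φ))

  from-injective : Injective _≡_ _≡_ from
  from-injective {v} {v′} eq = trans (sym (to-from v)) (trans (cong to eq) (to-from v′))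

  to-adj : ∀ u v → adj H (to u) (to v) ≡ adj G u v
  to-adj = proj₂ φ

≅⇒order≡ : ∀ {G H} → G ≅ H → order G ≡ order H
≅⇒order≡ {G} {H} φ = cantor-schröder-bernstein to-injective from-injective
  where open Iso {G} {H} φ

onto-embedding⇒≅ : ∀ {G H} (f : Fin (order G) → Fin (order H)) → Injective _≡_ _≡_ f →
                   (∀ v → ∃ λ u → f u ≡ v) → (∀ u u′ → adj H (f u) (f u′) ≡ adj G u u′) → G ≅ H
onto-embedding⇒≅ f f-inj f-onto f-adj =
  mk⤖ (f-inj , λ v → proj₁ (f-onto v) , λ { refl → proj₂ (f-onto v) }) , f-adj

module _ {K L G H : Graph} (φ : K ≅ L) where
  open Iso {K} {L} φ

  covering-≅ : Covering K G H → Covering L G H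
  covering-≅ c = record
    { f = to ∘ f ; k = to ∘ k
    ; f-inj = f-inj ∘ to-injective ; k-inj = k-inj ∘ to-injective
    ; cover = λ v → Sum.map (along v) (along v) (cover (from v))
    ; adjG = λ x x′ → trans (to-adj (f x) (f x′)) (adjG x x′)
    ; adjH = λ y y′ → trans (to-adj (k y) (k y′)) (adjH y y′)
    }
    where
    open Covering c
    along : ∀ {A : Set} {g : A → Fin (order K)} v → ∃ (λ a → g a ≡ from v) → ∃ λ a → to (g a) ≡ v
    along v (a , ga≡) = a , trans (cong to ga≡) (to-from v)

  join-≅ : Join K G H → Join L G H
  join-≅ (c , disjoint , complete) =
    covering-≅ c , (λ x y → disjoint x y ∘ to-injective) , λ x y → trans (to-adj _ _) (complete x y)

  zeroSum-≅ : ZeroSum K G H → ZeroSum L G H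
  zeroSum-≅ (c , disjoint , anticomplete) =
    covering-≅ c , (λ x y → disjoint x y ∘ to-injective) , λ x y → trans (to-adj _ _) (anticomplete x y)

  oneSum-≅ : OneSum K G H → OneSum L G H
  oneSum-≅ (c , g₀ , h₀ , glued , only-glued , apart) =
    covering-≅ c , g₀ , h₀ , cong to glued , (λ x y → only-glued x y ∘ to-injective) ,
    λ x y x≢g₀ y≢h₀ → trans (to-adj _ _) (apart x y x≢g₀ y≢h₀)

vertex : ∀ {G} → Sesqui G → Fin (order G)
vertex (k₁ order≡1)       = subst Fin (sym order≡1) zero
vertex (join sG _ (c , _)) = Covering.f c (vertex sG)
vertex (sum₀ sG _ (c , _)) = Covering.f c (vertex sG)
vertex (sum₁ sG _ (c , _)) = Covering.f c (vertex sG)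

module Side {K G H : Graph} (c : Covering K G H) where
  open Covering c

  side : Fin (order K) → Bool
  side v = does (any? λ x → f x ≟ᶠ v)

  side-f : ∀ x → side (f x) ≡ true
  side-f x with any? (λ x′ → f x′ ≟ᶠ f x)
  ... | yes _    = refl
  ... | no ¬in-f = contradiction (x , refl) ¬in-f

  side-k : ∀ y → (∀ x → f x ≢ k y) → side (k y) ≡ false
  side-k y only-k with any? (λ x → f x ≟ᶠ k y)
  ... | yes (x , fx≡ky) = contradiction fx≡ky (only-k x)
  ... | no _            = refl

  side-separates : ∀ x y → (∀ x′ → f x′ ≢ k y) → side (f x) ≢ side (k y)
  side-separates x y only-k eq = contradiction (trans (sym (side-f x)) (trans eq (side-k y only-k))) λ ()

  in-k : ∀ v → ¬ (∃ λ x → f x ≡ v) → ∃ λ y → k y ≡ v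
  in-k v ¬in-f = [ (λ in-f → contradiction in-f ¬in-f) , id ] (cover v)

  side-respects : (R : Fin (order K) → Fin (order K) → Set) → (∀ {u v} → R u v → R v u) →
                  (∀ x y → ¬ R (f x) (k y)) → ∀ {u v} → R u v → side u ≡ side v
  side-respects R R-sym no-cross {u} {v} Ruv = compare (any? λ x → f x ≟ᶠ u) (any? λ x → f x ≟ᶠ v)
    where
    crossing : ∀ {u v} → ∃ (λ x → f x ≡ u) → ∃ (λ y → k y ≡ v) → ¬ R u v
    crossing (x , refl) (y , refl) = no-cross x y

    compare : (p : Dec (∃ λ x → f x ≡ u)) (q : Dec (∃ λ x → f x ≡ v)) → does p ≡ does q
    compare (yes _)    (yes _)    = refl
    compare (no _)     (no _)     = refl
    compare (yes in-f) (no ¬in-f) = ⊥-elim (crossing in-f (in-k v ¬in-f) Ruv)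
    compare (no ¬in-f) (yes in-f) = ⊥-elim (crossing in-f (in-k u ¬in-f) (R-sym Ruv))

K₁ : Graph
K₁ = record { order = 1 ; adj = λ _ _ → false ; adj-sym = λ _ _ → refl ; adj-irr = λ _ → refl }

Fin1-injective : ∀ {A : Set} (g : Fin 1 → A) → Injective _≡_ _≡_ g
Fin1-injective g {zero} {zero} _ = refl

edge : ∀ {n} → Fin n → Fin n → Fin 2 → Fin n
edge u v zero    = u
edge u v (suc _) = v

edge-sesqui : (G : Graph) {u v : Fin (order G)} → adj G u v ≡ true → Sesqui (induced G (edge u v))
edge-sesqui G {u} {v} uv = join (k₁ refl) (k₁ refl) (halves , (λ _ _ ()) , λ _ _ → uv)
  where
  halves : Covering (induced G (edge u v)) K₁ K₁
  halves = record
    { f = λ _ → zero ; k = λ _ → suc zero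
    ; f-inj = Fin1-injective _ ; k-inj = Fin1-injective _
    ; cover = λ { zero → inj₁ (zero , refl) ; (suc zero) → inj₂ (zero , refl) }
    ; adjG = λ _ _ → adj-irr G u ; adjH = λ _ _ → adj-irr G v
    }

-- Any graph on Fin (suc m) written as an induced subgraph, so that deleting v stays of that form.
module VertexAddition (G : Graph) {m : ℕ} (e : Fin (suc m) → Fin (order G)) (v : Fin (suc m)) where
  K : Graph
  K = induced G e

  K∖v : Graph
  K∖v = induced K (punchIn v)

  punchIn-or-self : ∀ u → (∃ λ x → punchIn v x ≡ u) ⊎ v ≡ u
  punchIn-or-self u with v ≟ᶠ u
  ... | yes v≡u = inj₂ v≡u
  ... | no v≢u  = inj₁ (punchOut v≢u , punchIn-punchOut v≢u)

  isolated⇒sesqui : Sesqui K∖v → (∀ u → adj K v u ≡ false) → Sesqui K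
  isolated⇒sesqui sK∖v isolated =
    sum₀ sK∖v (k₁ refl) (parts , (λ x _ → punchInᵢ≢i v x) , λ x _ → trans (adj-sym K _ v) (isolated _))
    where
    parts : Covering K K∖v K₁
    parts = record
      { f = punchIn v ; k = λ _ → v
      ; f-inj = punchIn-injective v _ _ ; k-inj = Fin1-injective _
      ; cover = λ u → Sum.map id (λ v≡u → zero , v≡u) (punchIn-or-self u)
      ; adjG = λ _ _ → refl ; adjH = λ _ _ → adj-irr K v
      }

  pendant⇒sesqui : Sesqui K∖v → ∀ w → adj K v w ≡ true → (∀ u → adj K v u ≡ true → u ≡ w) → Sesqui K
  pendant⇒sesqui sK∖v w vw only-w =
    sum₁ sK∖v (edge-sesqui K (trans (adj-sym K w v) vw))
      (parts , w′ , zero , punchIn-punchOut v≢w , glued-only , apart)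
    where
    v≢w : v ≢ w
    v≢w refl = contradiction (trans (sym vw) (adj-irr K v)) λ ()

    w′ : Fin m
    w′ = punchOut v≢w

    parts : Covering K K∖v (induced K (edge w v))
    parts = record
      { f = punchIn v ; k = edge w v
      ; f-inj = punchIn-injective v _ _
      ; k-inj = λ { {zero} {zero} _ → refl ; {suc zero} {suc zero} _ → refl
                  ; {zero} {suc zero} w≡v → contradiction (sym w≡v) v≢w
                  ; {suc zero} {zero} v≡w → contradiction v≡w v≢w }
      ; cover = λ u → Sum.map id (λ v≡u → suc zero , v≡u) (punchIn-or-self u)
      ; adjG = λ _ _ → refl ; adjH = λ _ _ → refl
      }

    glued-only : ∀ x y → punchIn v x ≡ edge w v y → (x ≡ w′) × (y ≡ zero)
    glued-only x zero    x↦w = punchIn-injective v x w′ (trans x↦w (sym (punchIn-punchOut v≢w))) , refl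
    glued-only x (suc _) x↦v = contradiction x↦v (punchInᵢ≢i v x)

    apart : ∀ x y → x ≢ w′ → y ≢ zero → adj K (punchIn v x) (edge w v y) ≡ false
    apart x zero    _    y≢0 = contradiction refl y≢0
    apart x (suc _) x≢w′ _ with adj K v (punchIn v x) in vx
    ... | false = trans (adj-sym K _ v) vx
    ... | true  = contradiction (punchIn-injective v x w′ (trans (only-w _ vx) (sym (punchIn-punchOut v≢w)))) x≢w′

-- Induced subgraphs of paths

-- The graphs admitting such a labelling are exactly the induced subgraphs of paths.
record PathLabelling (G : Graph) : Set where
  field
    label           : Fin (order G) → ℕ
    label-injective : Injective _≡_ _≡_ label
    label-adjacent  : ∀ u v → adj G u v ≡ true → suc (label u) ≡ label v ⊎ suc (label v) ≡ label u

restrict : ∀ {G m} → PathLabelling G → (ι : Fin m → Fin (order G)) → Injective _≡_ _≡_ ι →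
           PathLabelling (induced G ι)
restrict ℓ ι ι-inj = record
  { label = label ∘ ι
  ; label-injective = ι-inj ∘ label-injective
  ; label-adjacent = λ u v → label-adjacent (ι u) (ι v)
  }
  where open PathLabelling ℓ

argmax : ∀ {m} (g : Fin (suc m) → ℕ) → ∃ λ v → ∀ u → g u ≤ g v
argmax {zero}  g = zero , λ { zero → ≤-refl }
argmax {suc m} g with argmax (g ∘ suc)
... | v , below-v with ≤-total (g zero) (g (suc v))
...   | inj₁ g0≤ = suc v , λ { zero → g0≤ ; (suc u) → below-v u }
...   | inj₂ ≤g0 = zero , λ { zero → ≤-refl ; (suc u) → ≤-trans (below-v u) ≤g0 }

pathLabelled⇒sesqui : ∀ {m} (G : Graph) (e : Fin (suc m) → Fin (order G)) →
                      PathLabelling (induced G e) → Sesqui (induced G e)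
pathLabelled⇒sesqui {zero}  G e _ = k₁ refl
pathLabelled⇒sesqui {suc m} G e ℓ = attach (any? λ u → adj K v u ≟ᵇ true)
  where
  open PathLabelling ℓ

  v : Fin (suc (suc m))
  v = proj₁ (argmax label)

  open VertexAddition G e v

  sK∖v : Sesqui K∖v
  sK∖v = pathLabelled⇒sesqui K (punchIn v) (restrict ℓ (punchIn v) (punchIn-injective v _ _))

  maximal : ∀ u → label u ≤ label v
  maximal = proj₂ (argmax label)

  neighbour-label : ∀ u → adj K v u ≡ true → suc (label u) ≡ label v
  neighbour-label u vu with label-adjacent v u vu
  ... | inj₁ 1+ℓv≡ℓu = contradiction (subst (label v <_) 1+ℓv≡ℓu ≤-refl) (≤⇒≯ (maximal u))
  ... | inj₂ 1+ℓu≡ℓv = 1+ℓu≡ℓv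

  attach : Dec (∃ λ u → adj K v u ≡ true) → Sesqui K
  attach (yes (w , vw)) = pendant⇒sesqui sK∖v w vw λ u vu →
    label-injective (suc-injective (trans (neighbour-label u vu) (sym (neighbour-label w vw))))
  attach (no ¬neighbour) = isolated⇒sesqui sK∖v λ u → ¬-not λ vu → ¬neighbour (u , vu)

stepwise-constant : ∀ {A : Set} (g : ℕ → A) {lo hi} → (∀ i → lo ≤ i → suc i < hi → g i ≡ g (suc i)) →
                    ∀ i → lo ≤ i → i < hi → g i ≡ g lo
stepwise-constant g step zero    z≤n      _      = refl
stepwise-constant g step (suc i) lo≤1+i 1+i<hi with m≤n⇒m<n∨m≡n lo≤1+i
... | inj₂ refl         = refl
... | inj₁ (s≤s lo≤i) =
  trans (sym (step i lo≤i 1+i<hi)) (stepwise-constant g step i lo≤i (<-trans (n<1+n i) 1+i<hi))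

-- Cycles

module Cycle (n : ℕ) where

  N : ℕ
  N = 3 + n

  C : Graph
  C = cycle n

  -- The edges of C are exactly the pairs vtx a, vtx (suc a), wrap-around included, so walking
  -- around the cycle becomes induction on ℕ.
  vtx : ℕ → Fin N
  vtx a = a mod N

  toℕ-vtx : ∀ a → toℕ (vtx a) ≡ a % N
  toℕ-vtx a = toℕ-fromℕ< (m%n<n a N)

  vtx-cong : ∀ a b → a % N ≡ b % N → vtx a ≡ vtx b
  vtx-cong a b eq = toℕ-injective (trans (toℕ-vtx a) (trans eq (sym (toℕ-vtx b))))

  vtx-toℕ : ∀ u → vtx (toℕ u) ≡ u
  vtx-toℕ u = toℕ-injective (trans (toℕ-vtx (toℕ u)) (m<n⇒m%n≡m (toℕ<n u)))

  vtx-periodic : ∀ a → vtx (a + N) ≡ vtx a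
  vtx-periodic a = vtx-cong (a + N) a ([m+n]%n≡m%n a N)

  vtx-+-toℕ : ∀ b a → vtx (b + toℕ (vtx a)) ≡ vtx (b + a)
  vtx-+-toℕ b a = vtx-cong (b + toℕ (vtx a)) (b + a) (begin
    (b + toℕ (vtx a)) % N   ≡⟨ cong (λ r → (b + r) % N) (toℕ-vtx a) ⟩
    (b + a % N) % N         ≡⟨ %-distribˡ-+ b (a % N) N ⟩
    (b % N + a % N % N) % N ≡⟨ cong (λ r → (b % N + r) % N) (m%n%n≡m%n a N) ⟩
    (b % N + a % N) % N     ≡⟨ %-distribˡ-+ b a N ⟨
    (b + a) % N             ∎)
    where open ≡-Reasoning

  next : Fin N → Fin N
  next u = vtx (suc (toℕ u))

  vtx-suc : ∀ a → vtx (suc a) ≡ next (vtx a)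
  vtx-suc a = sym (vtx-+-toℕ 1 a)

  prev : Fin N → Fin N
  prev u = vtx (2 + n + toℕ u)

  prev-next : ∀ u → prev (next u) ≡ u
  prev-next u = begin
    vtx (2 + n + toℕ (vtx (suc (toℕ u)))) ≡⟨ vtx-+-toℕ (2 + n) (suc (toℕ u)) ⟩
    vtx (2 + n + suc (toℕ u))             ≡⟨ cong vtx (+-comm (2 + n) (suc (toℕ u))) ⟩
    vtx (suc (toℕ u + (2 + n)))           ≡⟨ cong vtx (+-suc (toℕ u) (2 + n)) ⟨
    vtx (toℕ u + N)                       ≡⟨ vtx-periodic (toℕ u) ⟩
    vtx (toℕ u)                           ≡⟨ vtx-toℕ u ⟩
    u                                     ∎
    where open ≡-Reasoning

  next-injective : Injective _≡_ _≡_ next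
  next-injective {u} {v} eq = trans (sym (prev-next u)) (trans (cong prev eq) (prev-next v))

  vtx-window-injective : ∀ a {d d′} → d < N → d′ < N → vtx (a + d) ≡ vtx (a + d′) → d ≡ d′
  vtx-window-injective zero {d} {d′} d<N d′<N eq = begin
    d           ≡⟨ m<n⇒m%n≡m d<N ⟨
    d % N       ≡⟨ toℕ-vtx d ⟨
    toℕ (vtx d) ≡⟨ cong toℕ eq ⟩
    toℕ (vtx d′) ≡⟨ toℕ-vtx d′ ⟩
    d′ % N      ≡⟨ m<n⇒m%n≡m d′<N ⟩
    d′          ∎
    where open ≡-Reasoning
  vtx-window-injective (suc a) {d} {d′} d<N d′<N eq = vtx-window-injective a d<N d′<N
    (next-injective (trans (sym (vtx-suc (a + d))) (trans eq (vtx-suc (a + d′)))))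

  adj⇒next : ∀ u v → adj C u v ≡ true → v ≡ next u ⊎ u ≡ next v
  adj⇒next u v uv = Sum.map (forward u v) (forward v u) (Equivalence.to T-∨ (Equivalence.from T-≡ uv))
    where
    forward : ∀ u v → T (suc (toℕ u) % N ≡ᵇ toℕ v) → v ≡ next u
    forward u v t = toℕ-injective (trans (sym (≡ᵇ⇒≡ _ _ t)) (sym (toℕ-vtx (suc (toℕ u)))))

  adj-next : ∀ u → adj C u (next u) ≡ true
  adj-next u = Equivalence.to T-≡ (Equivalence.from T-∨ (inj₁ (≡⇒≡ᵇ _ _ (sym (toℕ-vtx (suc (toℕ u)))))))

  adj-vtx-suc : ∀ a → adj C (vtx a) (vtx (suc a)) ≡ true
  adj-vtx-suc a = subst (λ v → adj C (vtx a) v ≡ true) (sym (vtx-suc a)) (adj-next (vtx a))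

  vtx-+0 : ∀ a → vtx (a + 0) ≡ vtx a
  vtx-+0 a = cong vtx (+-identityʳ a)

  far-nonadjacent : ∀ a {d} → 2 ≤ d → suc d < N → adj C (vtx a) (vtx (a + d)) ≡ false
  far-nonadjacent a {suc d} (s≤s 1≤d) 2+d<N with adj C (vtx a) (vtx (a + suc d)) in a~a+d
  ... | false = refl
  ... | true  = ⊥-elim ([ behind , ahead ]′ (adj⇒next _ _ a~a+d))
    where
    behind : vtx (a + suc d) ≢ next (vtx a)
    behind eq = contradiction
      (vtx-window-injective (suc a) (<-trans (n<1+n d) (<-trans (n<1+n (suc d)) 2+d<N)) (s≤s z≤n)
        (trans (cong vtx (sym (+-suc a d))) (trans eq (trans (sym (vtx-suc a)) (sym (vtx-+0 (suc a)))))))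
      (λ d≡0 → <⇒≢ 1≤d (sym d≡0))
    ahead : vtx a ≢ next (vtx (a + suc d))
    ahead eq = contradiction
      (vtx-window-injective a (s≤s z≤n) 2+d<N
        (trans (vtx-+0 a) (trans eq (trans (sym (vtx-suc (a + suc d))) (cong vtx (sym (+-suc a (suc d))))))))
      λ ()

  -- The number of steps from w forward to u.
  offset : Fin N → Fin N → ℕ
  offset w u = toℕ (vtx (N ∸ toℕ w + toℕ u))

  offset<N : ∀ w u → offset w u < N
  offset<N w u = toℕ<n _

  vtx-offset : ∀ w u → vtx (toℕ w + offset w u) ≡ u
  vtx-offset w u = begin
    vtx (toℕ w + offset w u)            ≡⟨ vtx-+-toℕ (toℕ w) _ ⟩
    vtx (toℕ w + (N ∸ toℕ w + toℕ u))   ≡⟨ cong vtx (+-assoc (toℕ w) _ _) ⟨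
    vtx (toℕ w + (N ∸ toℕ w) + toℕ u)   ≡⟨ cong (λ m → vtx (m + toℕ u)) (m+[n∸m]≡n (<⇒≤ (toℕ<n w))) ⟩
    vtx (N + toℕ u)                     ≡⟨ cong vtx (+-comm N (toℕ u)) ⟩
    vtx (toℕ u + N)                     ≡⟨ vtx-periodic (toℕ u) ⟩
    vtx (toℕ u)                         ≡⟨ vtx-toℕ u ⟩
    u                                   ∎
    where open ≡-Reasoning

  offset-injective : ∀ w → Injective _≡_ _≡_ (offset w)
  offset-injective w {u} {v} eq =
    trans (sym (vtx-offset w u)) (trans (cong (λ d → vtx (toℕ w + d)) eq) (vtx-offset w v))

  vtx-offset-0 : ∀ w → vtx (toℕ w + 0) ≡ w
  vtx-offset-0 w = trans (vtx-+0 (toℕ w)) (vtx-toℕ w)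

  vtx-offset≢ : ∀ w {d} → 0 < d → d < N → vtx (toℕ w + d) ≢ w
  vtx-offset≢ w {d} 0<d d<N eq =
    <⇒≢ 0<d (sym (vtx-window-injective (toℕ w) d<N (s≤s z≤n) (trans eq (sym (vtx-offset-0 w)))))

  offset>0 : ∀ {w u} → u ≢ w → 0 < offset w u
  offset>0 {w} {u} u≢w = n≢0⇒n>0 λ o≡0 →
    u≢w (trans (sym (vtx-offset w u)) (trans (cong (λ d → vtx (toℕ w + d)) o≡0) (vtx-offset-0 w)))

  next-at-offset : ∀ w u → next u ≡ vtx (toℕ w + suc (offset w u))
  next-at-offset w u = begin
    next u                              ≡⟨ cong next (vtx-offset w u) ⟨
    next (vtx (toℕ w + offset w u))     ≡⟨ vtx-suc (toℕ w + offset w u) ⟨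
    vtx (suc (toℕ w + offset w u))      ≡⟨ cong vtx (+-suc (toℕ w) (offset w u)) ⟨
    vtx (toℕ w + suc (offset w u))      ∎
    where open ≡-Reasoning

  offset-next : ∀ w u → next u ≢ w → offset w (next u) ≡ suc (offset w u)
  offset-next w u next≢w with m≤n⇒m<n∨m≡n (offset<N w u)
  ... | inj₁ 1+o<N = vtx-window-injective (toℕ w) (offset<N w (next u)) 1+o<N
                       (trans (vtx-offset w (next u)) (next-at-offset w u))
  ... | inj₂ 1+o≡N = contradiction
                       (trans (next-at-offset w u) (trans (cong (λ d → vtx (toℕ w + d)) 1+o≡N)
                         (trans (vtx-periodic (toℕ w)) (vtx-toℕ w))))
                       next≢w

  offset-adjacent : ∀ w u v → u ≢ w → v ≢ w → adj C u v ≡ true →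
                    suc (offset w u) ≡ offset w v ⊎ suc (offset w v) ≡ offset w u
  offset-adjacent w u v u≢w v≢w uv =
    Sum.map (λ { refl → sym (offset-next w u v≢w) }) (λ { refl → sym (offset-next w v u≢w) })
            (adj⇒next u v uv)

  steps⇒constant : ∀ {A : Set} (s : Fin N → A) → (∀ a → s (vtx a) ≡ s (vtx (suc a))) → ∀ u v → s u ≡ s v
  steps⇒constant s step u v = trans (from-0 u) (sym (from-0 v))
    where
    from-0 : ∀ u → s u ≡ s (vtx 0)
    from-0 u = trans (cong s (sym (vtx-toℕ u)))
                 (stepwise-constant (s ∘ vtx) (λ i _ _ → step i) (toℕ u) z≤n (toℕ<n u))

  -- Connectivity is expressed by two-colourings: they must be constant once constant along edges.
  connected : (s : Fin N → Bool) → (∀ u v → adj C u v ≡ true → s u ≡ s v) → ∀ u v → s u ≡ s v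
  connected s s-edge = steps⇒constant s λ a → s-edge _ _ (adj-vtx-suc a)

  coconnected : 2 ≤ n → (s : Fin N → Bool) → (∀ u v → adj C u v ≡ false → s u ≡ s v) → ∀ u v → s u ≡ s v
  coconnected 2≤n s s-nonedge = steps⇒constant s λ a → begin
    s (vtx a)           ≡⟨ s-nonedge _ _ (far-nonadjacent a (s≤s (s≤s z≤n)) 5≤N) ⟩
    s (vtx (a + 3))     ≡⟨ cong (s ∘ vtx) (+-suc a 2) ⟩
    s (vtx (suc a + 2)) ≡⟨ s-nonedge _ _ (far-nonadjacent (suc a) ≤-refl (<⇒≤ 5≤N)) ⟨
    s (vtx (suc a))     ∎
    where
    open ≡-Reasoning
    5≤N : 5 ≤ N
    5≤N = +-monoʳ-≤ 3 2≤n

  connected-without : ∀ w (s : Fin N → Bool) → (∀ u v → u ≢ w → v ≢ w → adj C u v ≡ true → s u ≡ s v) →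
                      ∀ u v → u ≢ w → v ≢ w → s u ≡ s v
  connected-without w s s-edge u v u≢w v≢w = trans (around u u≢w) (sym (around v v≢w))
    where
    g : ℕ → Bool
    g d = s (vtx (toℕ w + d))

    step : ∀ d → 1 ≤ d → suc d < N → g d ≡ g (suc d)
    step d 1≤d 2+d<N =
      s-edge _ _ (vtx-offset≢ w 1≤d (<-trans (n<1+n d) 2+d<N)) (vtx-offset≢ w (s≤s z≤n) 2+d<N)
        (subst (λ x → adj C (vtx (toℕ w + d)) (vtx x) ≡ true) (sym (+-suc (toℕ w) d)) (adj-vtx-suc (toℕ w + d)))

    around : ∀ u → u ≢ w → s u ≡ g 1
    around u u≢w = trans (cong s (sym (vtx-offset w u)))
                     (stepwise-constant g step (offset w u) (offset>0 u≢w) (offset<N w u))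

  not-join : 2 ≤ n → ∀ {G H} → Join C G H → Fin (order G) → Fin (order H) → ⊥
  not-join 2≤n (c , disjoint , complete) x y =
    side-separates x y (λ x′ → disjoint x′ y) (coconnected 2≤n side constant-on-nonedges (f x) (k y))
    where
    open Covering c
    open Side c

    Nonadjacent : Fin N → Fin N → Set
    Nonadjacent u v = adj C u v ≡ false

    no-cross : ∀ x y → ¬ Nonadjacent (f x) (k y)
    no-cross x y fx≁ky = contradiction (trans (sym (complete x y)) fx≁ky) λ ()

    constant-on-nonedges : ∀ u v → Nonadjacent u v → side u ≡ side v
    constant-on-nonedges _ _ = side-respects Nonadjacent (λ {u} {v} → trans (adj-sym C v u)) no-cross

  not-zeroSum : ∀ {G H} → ZeroSum C G H → Fin (order G) → Fin (order H) → ⊥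
  not-zeroSum (c , disjoint , anticomplete) x y =
    side-separates x y (λ x′ → disjoint x′ y) (connected side constant-on-edges (f x) (k y))
    where
    open Covering c
    open Side c

    Adjacent : Fin N → Fin N → Set
    Adjacent u v = adj C u v ≡ true

    no-cross : ∀ x y → ¬ Adjacent (f x) (k y)
    no-cross x y fx∼ky = contradiction (trans (sym fx∼ky) (anticomplete x y)) λ ()

    constant-on-edges : ∀ u v → Adjacent u v → side u ≡ side v
    constant-on-edges _ _ = side-respects Adjacent (λ {u} {v} → trans (adj-sym C v u)) no-cross

  oneSum-trivial : ∀ {G H} → OneSum C G H → G ≅ C ⊎ H ≅ C
  oneSum-trivial {G} {H} (c , g₀ , h₀ , glued , only-glued , apart) =
    decide (all? (_≟ᶠ g₀)) (all? (_≟ᶠ h₀))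
    where
    open Covering c
    open Side c

    AdjacentAvoiding : Fin N → Fin N → Set
    AdjacentAvoiding u v = u ≢ f g₀ × v ≢ f g₀ × adj C u v ≡ true

    cut-vertex : ∃ (λ x → x ≢ g₀) → ∃ (λ y → y ≢ h₀) → ⊥
    cut-vertex (x , x≢g₀) (y , y≢h₀) =
      side-separates x y (λ x′ fx′≡ky → y≢h₀ (proj₂ (only-glued x′ y fx′≡ky)))
        (connected-without (f g₀) side constant-off-cut (f x) (k y) (x≢g₀ ∘ f-inj)
          (λ ky≡fg₀ → y≢h₀ (k-inj (trans ky≡fg₀ glued))))
      where
      avoiding-sym : ∀ {u v} → AdjacentAvoiding u v → AdjacentAvoiding v u
      avoiding-sym {u} {v} (u≢ , v≢ , uv) = v≢ , u≢ , trans (adj-sym C v u) uv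
      no-cross : ∀ x y → ¬ AdjacentAvoiding (f x) (k y)
      no-cross x y (fx≢ , ky≢ , fx∼ky) =
        contradiction (trans (sym fx∼ky) (apart x y (λ { refl → fx≢ refl }) (λ { refl → ky≢ (sym glued) })))
                      λ ()

      constant-off-cut : ∀ u v → u ≢ f g₀ → v ≢ f g₀ → adj C u v ≡ true → side u ≡ side v
      constant-off-cut _ _ u≢ v≢ uv = side-respects AdjacentAvoiding avoiding-sym no-cross (u≢ , v≢ , uv)

    decide : Dec (∀ x → x ≡ g₀) → Dec (∀ y → y ≡ h₀) → G ≅ C ⊎ H ≅ C
    decide (yes only-g₀) _ = inj₂ (onto-embedding⇒≅ {H} {C} k k-inj k-onto adjH)
      where
      k-onto : ∀ v → ∃ λ y → k y ≡ v
      k-onto v = [ (λ { (x , refl) → h₀ , trans (sym glued) (cong f (sym (only-g₀ x))) }) , id ]′ (cover v)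
    decide _ (yes only-h₀) = inj₁ (onto-embedding⇒≅ {G} {C} f f-inj f-onto adjG)
      where
      f-onto : ∀ v → ∃ λ x → f x ≡ v
      f-onto v = [ id , (λ { (y , refl) → g₀ , trans glued (cong k (sym (only-h₀ y))) }) ]′ (cover v)
    decide (no ¬only-g₀) (no ¬only-h₀) =
      ⊥-elim (cut-vertex (¬∀⟶∃¬ _ _ (_≟ᶠ g₀) ¬only-g₀) (¬∀⟶∃¬ _ _ (_≟ᶠ h₀) ¬only-h₀))

sesqui≇cycle : ∀ {K n} → Sesqui K → 2 ≤ n → ¬ (K ≅ cycle n)
sesqui≇cycle {K} {n} (k₁ order≡1) _ φ = contradiction (trans (sym order≡1) (≅⇒order≡ {K} {cycle n} φ)) λ ()
sesqui≇cycle {K} {n} (join sG sH j) 2≤n φ =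
  Cycle.not-join n 2≤n (join-≅ {K} {cycle n} φ j) (vertex sG) (vertex sH)
sesqui≇cycle {K} {n} (sum₀ sG sH z) _ φ =
  Cycle.not-zeroSum n (zeroSum-≅ {K} {cycle n} φ z) (vertex sG) (vertex sH)
sesqui≇cycle {K} {n} (sum₁ sG sH o) 2≤n φ =
  [ sesqui≇cycle sG 2≤n , sesqui≇cycle sH 2≤n ]′ (Cycle.oneSum-trivial n (oneSum-≅ {K} {cycle n} φ o))

∃-missed : ∀ {m n} → m < n → (e : Fin m → Fin n) → ∃ λ z → ∀ u → e u ≢ z
∃-missed {m} {n} m<n e with ¬∀⟶∃¬ n (λ z → ∃ λ u → e u ≡ z) (λ z → any? λ u → e u ≟ᶠ z) not-onto
  where
  not-onto : ¬ (∀ z → ∃ λ u → e u ≡ z)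
  not-onto onto with pigeonhole m<n (proj₁ ∘ onto)
  ... | i , j , i<j , same =
    <⇒≢ i<j (cong toℕ (trans (sym (proj₂ (onto i))) (trans (cong e same) (proj₂ (onto j)))))
... | z , unhit = z , λ u eu≡z → unhit (u , eu≡z)

cycle-minus-vertex-pathLabelled : ∀ {G n m} → G ≅ cycle n → (e : Fin m → Fin (order G)) → Injective _≡_ _≡_ e →
                                  ∀ z → (∀ u → e u ≢ z) → PathLabelling (induced G e)
cycle-minus-vertex-pathLabelled {G} {n} φ e e-inj z missed = record
  { label = λ u → offset (to z) (to (e u))
  ; label-injective = e-inj ∘ to-injective ∘ offset-injective (to z)
  ; label-adjacent = λ u v uv → offset-adjacent (to z) _ _ (avoids u) (avoids v) (trans (to-adj (e u) (e v)) uv)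
  }
  where
  open Iso {G} {cycle n} φ
  open Cycle n
  avoids : ∀ u → to (e u) ≢ to z
  avoids u = missed u ∘ to-injective

cycle-induced-sesqui : ∀ {G n m} → G ≅ cycle n → (e : Fin m → Fin (order G)) → Injective _≡_ _≡_ e →
                       1 ≤ m → m < order G → Sesqui (induced G e)
cycle-induced-sesqui {G} {n} φ e e-inj (s≤s z≤n) m<order with ∃-missed m<order e
... | z , missed = pathLabelled⇒sesqui G e (cycle-minus-vertex-pathLabelled {G} {n} φ e e-inj z missed)

lemma3p1 : (G : Graph) (k : ℕ) → 4 < 3 + k → G ≅ cycle k → MinimalNonSesqui G
lemma3p1 G k (s≤s (s≤s (s≤s 2≤k))) φ =
  (λ sG → sesqui≇cycle {G} {k} sG 2≤k φ) , cycle-induced-sesqui {G} {k} φ
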